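{- Let $b,c$ be integers, $f(x)=x^2-bx-c$, $\Delta=b^2+4c$, and let $n>1$ be an integer with $\gcd(n,2f(0)\Delta)=1$. If $\left(\frac{\Delta}{n}\right)=1$ and $x^n\equiv x\pmod{(n,f(x))}$, then $n$ is a Frobenius probable prime with respect to $f(x)$. If $\left(\frac{\Delta}{n}\right)=-1$ and $x^n\equiv b-x\pmod{(n,f(x))}$, then $n$ is a Frobenius probable prime with respect to $f(x)$.
   Context: Congruence mod $(n,f(x))$ means equality in $\mathbb{Z}[x]/(n,f(x))$; $\left(\frac{\cdot}{n}\right)$ is the Jacobi symbol. For monic polynomials $g_1,g_2$ over a commutative ring $R$ with identity, a monic $h\in R[x]$ is $\operatorname{gcmd}(g_1,g_2)$ if the ideal generated by $g_1,g_2$ equals the ideal generated by $h$ (it may fail to exist). Let $f(x)\in\mathbb{Z}[x]$ be monic of degree $d$ with discriminant $\Delta$. An odd integer $n>1$ is a Frobenius probable prime with respect to $f$ if $\gcd(n,f(0)\Delta)=1$ and, with all computations in $(\mathbb{Z}/n\mathbb{Z})[x]$: (Factorization) setting $f_0=f\bmod n$ and, for $1\le i\le d$, $F_i=\operatorname{gcmd}(x^{n^i}-x,f_{i-1})$ and $f_i=f_{i-1}/F_i$, all these gcmds exist and $f_d=1$; (Frobenius) for $2\le i\le d$, $F_i(x^n)\equiv 0\pmod{F_i(x)}$; (Jacobi) with $S=\sum_{2\mid i}\deg(F_i)/i$, $(-1)^S=\left(\frac{\Delta}{n}\right)$. -}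

module Defs where

open import Data.Nat as ℕ using (ℕ; zero; suc; _≤_; _<_; _≡ᵇ_)
open import Data.Nat.Primality using (Prime)
import Data.Nat.Divisibility as ℕD
open import Data.Nat.DivMod using (_/_; _%_)
open import Data.Integer as ℤ using (ℤ; +_; -_; _+_; _-_; _*_)
open import Data.Integer.Divisibility using (_∣_)
open import Data.Integer.GCD using (gcd)
open import Data.List using (List; []; _∷_; _++_; reverse; replicate; map; upTo; length)
open import Data.Product using (Σ; _×_; _,_; ∃; ∃-syntax)
open import Data.Bool using (if_then_else_)
open import Relation.Nullary using (¬_)
open import Relation.Binary.PropositionalEquality using (_≡_)

-- Polynomials with integer coefficients, as coefficient lists
-- (lowest degree first).  Polynomials over ℤ/nℤ are represented by
-- integer polynomials, compared with the equality `_≈[ n ]_` below.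

Poly : Set
Poly = List ℤ

coeff : Poly → ℕ → ℤ
coeff []      _       = + 0
coeff (a ∷ p) zero    = a
coeff (a ∷ p) (suc i) = coeff p i

infixl 6 _+ₚ_ _-ₚ_
infixl 7 _*ₚ_

_+ₚ_ : Poly → Poly → Poly
[]      +ₚ q       = q
(a ∷ p) +ₚ []      = a ∷ p
(a ∷ p) +ₚ (b ∷ q) = (a + b) ∷ (p +ₚ q)

negₚ : Poly → Poly
negₚ = map (λ a → - a)

_-ₚ_ : Poly → Poly → Poly
p -ₚ q = p +ₚ negₚ q

_*ₚ_ : Poly → Poly → Poly
[]      *ₚ q = []
(a ∷ p) *ₚ q = map (a *_) q +ₚ (+ 0 ∷ (p *ₚ q))

constₚ : ℤ → Poly
constₚ a = a ∷ []

X : Poly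
X = + 0 ∷ + 1 ∷ []

oneₚ : Poly
oneₚ = constₚ (+ 1)

_^ₚ_ : Poly → ℕ → Poly
p ^ₚ zero  = oneₚ
p ^ₚ suc k = p *ₚ (p ^ₚ k)

compose : Poly → Poly → Poly
compose []      q = []
compose (a ∷ p) q = constₚ a +ₚ (q *ₚ compose p q)

deriv : Poly → Poly
deriv []      = []
deriv (a ∷ p) = go 1 p
  where
  go : ℕ → Poly → Poly
  go k []      = []
  go k (b ∷ r) = (+ k * b) ∷ go (suc k) r

-- The monic polynomial with lower coefficients cs (lowest first):
-- cs₀ + cs₁ x + … + cs_{d-1} x^{d-1} + x^d.  Its degree is length cs.
monic : List ℤ → Poly
monic cs = cs ++ (+ 1 ∷ [])

_≈[_]_ : Poly → ℕ → Poly → Set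
p ≈[ n ] q = ∀ i → (+ n) ∣ (coeff p i - coeff q i)

CongMod : Poly → Poly → ℕ → Poly → Set
CongMod p q n g = ∃[ r ] ((p -ₚ q) ≈[ n ] (r *ₚ g))

-- h = monic hcs is gcmd(g₁, g₂) in (ℤ/nℤ)[x]: the ideal (g₁, g₂)
-- equals the ideal (h).
IsGcmd : ℕ → Poly → Poly → List ℤ → Set
IsGcmd n g₁ g₂ hcs =
  (∃[ a ] ∃[ b ] (monic hcs ≈[ n ] ((a *ₚ g₁) +ₚ (b *ₚ g₂))))
  × (∃[ u ] (g₁ ≈[ n ] (u *ₚ monic hcs)))
  × (∃[ v ] (g₂ ≈[ n ] (v *ₚ monic hcs)))

-- Discriminant of a monic polynomial: (-1)^{d(d-1)/2} Res(f, f'),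
-- with the resultant given by the Sylvester determinant.

negOnePow : ℕ → ℤ
negOnePow zero    = + 1
negOnePow (suc k) = - negOnePow k

dropAt : {A : Set} → ℕ → List A → List A
dropAt _       []       = []
dropAt zero    (x ∷ xs) = xs
dropAt (suc j) (x ∷ xs) = x ∷ dropAt j xs

det : ℕ → List (List ℤ) → ℤ
det zero    _            = + 1
det (suc m) []           = + 1
det (suc m) (row ∷ rows) = lapl 0 row
  where
  lapl : ℕ → List ℤ → ℤ
  lapl j []       = + 0
  lapl j (e ∷ es) = (negOnePow j * e * det m (map (dropAt j) rows)) + lapl (suc j) es

-- Sylvester matrix of f (degree d, monic) and f' (degree d-1),
-- coefficients written highest degree first.
sylvesterRows : List ℤ → List (List ℤ)
sylvesterRows cs =
  map (λ r → replicate r (+ 0) ++ fH ++ replicate ((d ℕ.∸ 2) ℕ.∸ r) (+ 0)) (upTo (d ℕ.∸ 1))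
  ++ map (λ s → replicate s (+ 0) ++ dH ++ replicate ((d ℕ.∸ 1) ℕ.∸ s) (+ 0)) (upTo d)
  where
  d  = length cs
  fH = reverse (monic cs)
  dH = reverse (deriv (monic cs))

disc : List ℤ → ℤ
disc cs = negOnePow ((d ℕ.* (d ℕ.∸ 1)) / 2) * det ((2 ℕ.* d) ℕ.∸ 1) (sylvesterRows cs)
  where d = length cs

-- Legendre and Jacobi symbols (as relations; they are functional).

data Legendre (a : ℤ) (p : ℕ) : ℤ → Set where
  leg0   : (+ p) ∣ a → Legendre a p (+ 0)
  legQR  : ¬ ((+ p) ∣ a) → (∃[ x ] ((+ p) ∣ (x * x - a))) → Legendre a p (+ 1)
  legQNR : ¬ ((+ p) ∣ a) → (∀ x → ¬ ((+ p) ∣ (x * x - a))) → Legendre a p (- + 1)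

data Jacobi (a : ℤ) : ℕ → ℤ → Set where
  jac1 : Jacobi a 1 (+ 1)
  jacP : ∀ {p m l j} → Prime p → Legendre a p l → Jacobi a m j → Jacobi a (p ℕ.* m) (l * j)

-- Frobenius probable primes (Grantham), for f = monic cs of degree
-- d = length cs.  F i  is the lower-coefficient list of the monic F_i,
-- g i  that of f_i.

Ssum : (ℕ → List ℤ) → ℕ → ℕ
Ssum F zero    = 0
Ssum F (suc k) = Ssum F k ℕ.+ (if (suc k % 2) ≡ᵇ 0 then length (F (suc k)) / suc k else 0)

FrobeniusPP : ℕ → List ℤ → Set
FrobeniusPP n cs =
  ¬ (2 ℕD.∣ n) × 1 < n
  × gcd (+ n) (coeff (monic cs) 0 * disc cs) ≡ + 1
  × Σ (ℕ → List ℤ) λ F → Σ (ℕ → List ℤ) λ g →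
      (g 0 ≡ cs)
      × (∀ i → 1 ≤ i → i ≤ d →
           IsGcmd n ((X ^ₚ (n ℕ.^ i)) -ₚ X) (monic (g (i ℕ.∸ 1))) (F i))
      × (∀ i → 1 ≤ i → i ≤ d →
           monic (g (i ℕ.∸ 1)) ≈[ n ] (monic (F i) *ₚ monic (g i)))
      × (g d ≡ [])
      × (∀ i → 2 ≤ i → i ≤ d →
           ∃[ q ] (compose (monic (F i)) (X ^ₚ n) ≈[ n ] (q *ₚ monic (F i))))
      × Jacobi (disc cs) n (negOnePow (Ssum F d))
  where d = length cs

{-# OPTIONS --safe #-}
-- Put σ = b − x for f = x² − bx − c; then f ∘ σ = f, σ ∘ σ = x and (σ − x)² = Δ + 4f.
-- If xⁿ ≡ x mod (n, f), the factorisation is F₁ = f, F₂ = 1 and S = 0.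
-- If xⁿ ≡ σ, it is F₁ = 1, F₂ = f and S = 1: the ideal (xⁿ − x, f) is everything because
-- xⁿ − x ≡ σ − x squares to Δ, a unit mod n; and as substituting σ preserves (n, f),
-- x^{n²} ≡ σⁿ = xⁿ ∘ σ ≡ σ ∘ σ = x and f(xⁿ) ≡ f(σ) = f ≡ 0.
-- The Jacobi step is the hypothesis, since disc f = Δ.
module Submission where

open import Defs
open import Algebra.Bundles using (CommutativeRing)
open import Data.Integer as ℤ using (ℤ; +_; -_; _+_; _-_; _*_)
import Data.Integer.Properties as ℤ
import Data.Integer.Divisibility as Unsigned
open import Data.Integer.Divisibility.Signed
  using (_∣_; divides; ∣-refl; ∣ᵤ⇒∣; ∣⇒∣ᵤ; ∣m∣n⇒∣m+n; ∣m⇒∣-m; ∣m⇒∣m*n; ∣n⇒∣m*n; 0∣⇒≡0)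
open import Data.Integer.GCD using (gcd; gcd[i,j]∣i; gcd[i,j]∣j; gcd-greatest)
open import Data.Integer.Tactic.RingSolver using (solve; solve-∀)
open import Data.List using (List; []; _∷_; map)
open import Data.Maybe using (Maybe; just; nothing)
open import Data.Nat as ℕ using (ℕ; zero; suc; _≤_; _<_; s≤s)
import Data.Nat.Properties as ℕ
import Data.Nat.Divisibility as ℕ
open import Data.Nat.Coprimality using (Coprime; gcd≡1⇒coprime; coprime-Bézout)
open import Data.Nat.GCD using (module Bézout)
open import Data.Product using (_×_; ∃-syntax; _,_)
open import Data.Sum using (inj₁; inj₂)
open import Level using (0ℓ)
open import Relation.Binary.Bundles using (Setoid)
open import Relation.Binary.PropositionalEquality
  using (_≡_; _≗_; refl; sym; trans; cong; cong₂; subst; module ≡-Reasoning)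
open import Relation.Nullary using (¬_; yes; no)
open import Tactic.RingSolver.Core.AlmostCommutativeRing using (AlmostCommutativeRing; fromCommutativeRing)
import Tactic.RingSolver as Poly-solver

coeff-+ : ∀ p q i → coeff (p +ₚ q) i ≡ coeff p i + coeff q i
coeff-+ []      q       i       = sym (ℤ.+-identityˡ _)
coeff-+ (a ∷ p) []      i       = sym (ℤ.+-identityʳ _)
coeff-+ (a ∷ p) (b ∷ q) zero    = refl
coeff-+ (a ∷ p) (b ∷ q) (suc i) = coeff-+ p q i

coeff-neg : ∀ p i → coeff (negₚ p) i ≡ - coeff p i
coeff-neg []      i       = refl
coeff-neg (a ∷ p) zero    = refl
coeff-neg (a ∷ p) (suc i) = coeff-neg p i

coeff-- : ∀ p q i → coeff (p -ₚ q) i ≡ coeff p i - coeff q i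
coeff-- p q i = trans (coeff-+ p (negₚ q) i) (cong (_+_ (coeff p i)) (coeff-neg q i))

coeff-map-* : ∀ a q i → coeff (map (a *_) q) i ≡ a * coeff q i
coeff-map-* a []      i       = sym (ℤ.*-zeroʳ a)
coeff-map-* a (b ∷ q) zero    = refl
coeff-map-* a (b ∷ q) (suc i) = coeff-map-* a q i

coeff-∷-*-zero : ∀ a p q → coeff ((a ∷ p) *ₚ q) 0 ≡ a * coeff q 0
coeff-∷-*-zero a p q =
  trans (coeff-+ (map (a *_) q) (+ 0 ∷ p *ₚ q) 0)
        (trans (ℤ.+-identityʳ _) (coeff-map-* a q 0))

coeff-∷-*-suc : ∀ a p q i → coeff ((a ∷ p) *ₚ q) (suc i) ≡ a * coeff q (suc i) + coeff (p *ₚ q) i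
coeff-∷-*-suc a p q i =
  trans (coeff-+ (map (a *_) q) (+ 0 ∷ p *ₚ q) (suc i))
        (cong (_+ coeff (p *ₚ q) i) (coeff-map-* a q (suc i)))

+ₚ-assoc : ∀ p q r → (p +ₚ q) +ₚ r ≡ p +ₚ (q +ₚ r)
+ₚ-assoc []      q       r       = refl
+ₚ-assoc (a ∷ p) []      r       = refl
+ₚ-assoc (a ∷ p) (b ∷ q) []      = refl
+ₚ-assoc (a ∷ p) (b ∷ q) (c ∷ r) = cong₂ _∷_ (ℤ.+-assoc a b c) (+ₚ-assoc p q r)

+ₚ-comm : ∀ p q → p +ₚ q ≡ q +ₚ p
+ₚ-comm []      []      = refl
+ₚ-comm []      (b ∷ q) = refl
+ₚ-comm (a ∷ p) []      = refl
+ₚ-comm (a ∷ p) (b ∷ q) = cong₂ _∷_ (ℤ.+-comm a b) (+ₚ-comm p q)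

+ₚ-identityʳ : ∀ p → p +ₚ [] ≡ p
+ₚ-identityʳ []      = refl
+ₚ-identityʳ (a ∷ p) = refl

coeff-+ₚ-inverseˡ : ∀ p i → coeff (negₚ p +ₚ p) i ≡ coeff [] i
coeff-+ₚ-inverseˡ p i =
  trans (coeff-+ (negₚ p) p i) (trans (cong (_+ coeff p i) (coeff-neg p i)) (ℤ.+-inverseˡ (coeff p i)))

private
  [a+b]x+[s+t]≡[ax+s]+[bx+t] : ∀ a b x s t → (a + b) * x + (s + t) ≡ (a * x + s) + (b * x + t)
  [a+b]x+[s+t]≡[ax+s]+[bx+t] = solve-∀
  [-a]x+[-s]≡-[ax+s] : ∀ a x s → (- a) * x + (- s) ≡ - (a * x + s)
  [-a]x+[-s]≡-[ax+s] = solve-∀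
  by+[ax+s]≡ax+[by+s] : ∀ a x b y s → b * y + (a * x + s) ≡ a * x + (b * y + s)
  by+[ax+s]≡ax+[by+s] = solve-∀
  [ab]x+as≡a[bx+s] : ∀ a b x s → (a * b) * x + a * s ≡ a * (b * x + s)
  [ab]x+as≡a[bx+s] = solve-∀

coeff-*-distribʳ : ∀ r p q i → coeff ((p +ₚ q) *ₚ r) i ≡ coeff (p *ₚ r) i + coeff (q *ₚ r) i
coeff-*-distribʳ r []      q       i       = sym (ℤ.+-identityˡ _)
coeff-*-distribʳ r (a ∷ p) []      i       = sym (ℤ.+-identityʳ _)
coeff-*-distribʳ r (a ∷ p) (b ∷ q) zero    =
  trans (coeff-∷-*-zero (a + b) (p +ₚ q) r)
    (trans (ℤ.*-distribʳ-+ (coeff r 0) a b)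
      (sym (cong₂ _+_ (coeff-∷-*-zero a p r) (coeff-∷-*-zero b q r))))
coeff-*-distribʳ r (a ∷ p) (b ∷ q) (suc i) =
  trans (coeff-∷-*-suc (a + b) (p +ₚ q) r i)
    (trans (cong (_+_ ((a + b) * coeff r (suc i))) (coeff-*-distribʳ r p q i))
      (trans ([a+b]x+[s+t]≡[ax+s]+[bx+t] a b (coeff r (suc i)) _ _)
        (sym (cong₂ _+_ (coeff-∷-*-suc a p r i) (coeff-∷-*-suc b q r i)))))

coeff-neg-* : ∀ p q i → coeff (negₚ p *ₚ q) i ≡ - coeff (p *ₚ q) i
coeff-neg-* []      q i       = refl
coeff-neg-* (a ∷ p) q zero    =
  trans (coeff-∷-*-zero (- a) (negₚ p) q)
    (trans (sym (ℤ.neg-distribˡ-* a (coeff q 0))) (cong -_ (sym (coeff-∷-*-zero a p q))))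
coeff-neg-* (a ∷ p) q (suc i) =
  trans (coeff-∷-*-suc (- a) (negₚ p) q i)
    (trans (cong (_+_ (- a * coeff q (suc i))) (coeff-neg-* p q i))
      (trans ([-a]x+[-s]≡-[ax+s] a (coeff q (suc i)) _) (cong -_ (sym (coeff-∷-*-suc a p q i)))))

coeff-*-zeroʳ : ∀ p i → coeff (p *ₚ []) i ≡ + 0
coeff-*-zeroʳ []      i       = refl
coeff-*-zeroʳ (a ∷ p) zero    = trans (coeff-∷-*-zero a p []) (ℤ.*-zeroʳ a)
coeff-*-zeroʳ (a ∷ p) (suc i) =
  trans (coeff-∷-*-suc a p [] i) (cong₂ _+_ (ℤ.*-zeroʳ a) (coeff-*-zeroʳ p i))

coeff-*-∷-zero : ∀ q a p → coeff (q *ₚ (a ∷ p)) 0 ≡ a * coeff q 0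
coeff-*-∷-zero []      a p = sym (ℤ.*-zeroʳ a)
coeff-*-∷-zero (b ∷ q) a p = trans (coeff-∷-*-zero b q (a ∷ p)) (ℤ.*-comm b a)

coeff-*-∷-suc : ∀ q a p i → coeff (q *ₚ (a ∷ p)) (suc i) ≡ a * coeff q (suc i) + coeff (q *ₚ p) i
coeff-*-∷-suc []      a p i       = sym (cong (_+ + 0) (ℤ.*-zeroʳ a))
coeff-*-∷-suc (b ∷ q) a p zero    =
  trans (coeff-∷-*-suc b q (a ∷ p) 0)
    (trans (cong (_+_ (b * coeff p 0)) (coeff-*-∷-zero q a p))
      (trans (ℤ.+-comm (b * coeff p 0) (a * coeff q 0)) (cong (_+_ (a * coeff q 0)) (sym (coeff-∷-*-zero b q p)))))
coeff-*-∷-suc (b ∷ q) a p (suc i) =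
  trans (coeff-∷-*-suc b q (a ∷ p) (suc i))
    (trans (cong (_+_ (b * coeff p (suc i))) (coeff-*-∷-suc q a p i))
      (trans (by+[ax+s]≡ax+[by+s] a (coeff q (suc i)) b (coeff p (suc i)) _)
        (cong (_+_ (a * coeff q (suc i))) (sym (coeff-∷-*-suc b q p i)))))

coeff-*-comm : ∀ p q i → coeff (p *ₚ q) i ≡ coeff (q *ₚ p) i
coeff-*-comm []      q i       = sym (coeff-*-zeroʳ q i)
coeff-*-comm (a ∷ p) q zero    = trans (coeff-∷-*-zero a p q) (sym (coeff-*-∷-zero q a p))
coeff-*-comm (a ∷ p) q (suc i) =
  trans (coeff-∷-*-suc a p q i)
    (trans (cong (_+_ (a * coeff q (suc i))) (coeff-*-comm p q i)) (sym (coeff-*-∷-suc q a p i)))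

coeff-map-*-* : ∀ a q r i → coeff (map (a *_) q *ₚ r) i ≡ a * coeff (q *ₚ r) i
coeff-map-*-* a []      r i       = sym (ℤ.*-zeroʳ a)
coeff-map-*-* a (b ∷ q) r zero    =
  trans (coeff-∷-*-zero (a * b) (map (a *_) q) r)
    (trans (ℤ.*-assoc a b (coeff r 0)) (cong (a *_) (sym (coeff-∷-*-zero b q r))))
coeff-map-*-* a (b ∷ q) r (suc i) =
  trans (coeff-∷-*-suc (a * b) (map (a *_) q) r i)
    (trans (cong (_+_ (a * b * coeff r (suc i))) (coeff-map-*-* a q r i))
      (trans ([ab]x+as≡a[bx+s] a b (coeff r (suc i)) _) (cong (a *_) (sym (coeff-∷-*-suc b q r i)))))

coeff-0∷-* : ∀ p q i → coeff ((+ 0 ∷ p) *ₚ q) i ≡ coeff (+ 0 ∷ p *ₚ q) i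
coeff-0∷-* p q zero    = coeff-∷-*-zero (+ 0) p q
coeff-0∷-* p q (suc i) = trans (coeff-∷-*-suc (+ 0) p q i) (ℤ.+-identityˡ _)

coeff-*-assoc : ∀ p q r i → coeff ((p *ₚ q) *ₚ r) i ≡ coeff (p *ₚ (q *ₚ r)) i
coeff-*-assoc []      q r i       = refl
coeff-*-assoc (a ∷ p) q r zero    =
  trans (coeff-*-distribʳ r (map (a *_) q) (+ 0 ∷ p *ₚ q) 0)
    (trans (cong₂ _+_ (coeff-map-*-* a q r 0) (coeff-0∷-* (p *ₚ q) r 0))
      (trans (ℤ.+-identityʳ _) (sym (coeff-∷-*-zero a p (q *ₚ r)))))
coeff-*-assoc (a ∷ p) q r (suc i) =
  trans (coeff-*-distribʳ r (map (a *_) q) (+ 0 ∷ p *ₚ q) (suc i))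
    (trans (cong₂ _+_ (coeff-map-*-* a q r (suc i))
                      (trans (coeff-0∷-* (p *ₚ q) r (suc i)) (coeff-*-assoc p q r i)))
      (sym (coeff-∷-*-suc a p (q *ₚ r) i)))

coeff-*-identityˡ : ∀ p i → coeff (oneₚ *ₚ p) i ≡ coeff p i
coeff-*-identityˡ p zero    = trans (coeff-∷-*-zero (+ 1) [] p) (ℤ.*-identityˡ _)
coeff-*-identityˡ p (suc i) =
  trans (coeff-∷-*-suc (+ 1) [] p i) (trans (ℤ.+-identityʳ _) (ℤ.*-identityˡ _))

-- The ring (ℤ/nℤ)[x]

-- _≈[_]_ as a record over signed divisibility: unification can then recover p and q,
-- and the reflective solver reads the last two arguments as the two sides.
record CoeffCongruent (n : ℕ) (p q : Poly) : Set where
  constructor mk≋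
  field ∣coeff-diff : ∀ i → + n ∣ coeff p i - coeff q i
open CoeffCongruent public

infix 4 CoeffCongruent
syntax CoeffCongruent n p q = p ≋[ n ] q

≈⇒≋ : ∀ {n p q} → p ≈[ n ] q → p ≋[ n ] q
≈⇒≋ e = mk≋ λ i → ∣ᵤ⇒∣ (e i)

≋⇒≈ : ∀ {n p q} → p ≋[ n ] q → p ≈[ n ] q
≋⇒≈ e i = ∣⇒∣ᵤ (∣coeff-diff e i)

private
  -[a-b]≡b-a : ∀ a b → - (a - b) ≡ b - a
  -[a-b]≡b-a = solve-∀
  [a-b]+[b-c]≡a-c : ∀ a b c → (a - b) + (b - c) ≡ a - c
  [a-b]+[b-c]≡a-c = solve-∀
  [a-c]+[b-d]≡[a+b]-[c+d] : ∀ a b c d → (a - c) + (b - d) ≡ (a + b) - (c + d)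
  [a-c]+[b-d]≡[a+b]-[c+d] = solve-∀
  -[a-b]≡-a--b : ∀ a b → - (a - b) ≡ - a - - b
  -[a-b]≡-a--b = solve-∀

∣coeff-* : ∀ {k} p q → (∀ i → k ∣ coeff p i) → ∀ i → k ∣ coeff (p *ₚ q) i
∣coeff-* []      q k∣p i       = divides (+ 0) refl
∣coeff-* (a ∷ p) q k∣p zero    =
  subst (_ ∣_) (sym (coeff-∷-*-zero a p q)) (∣m⇒∣m*n (coeff q 0) (k∣p 0))
∣coeff-* (a ∷ p) q k∣p (suc i) =
  subst (_ ∣_) (sym (coeff-∷-*-suc a p q i))
    (∣m∣n⇒∣m+n (∣m⇒∣m*n (coeff q (suc i)) (k∣p 0)) (∣coeff-* p q (λ j → k∣p (suc j)) i))

module _ {n : ℕ} where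

  ≗⇒≋ : ∀ {p q} → coeff p ≗ coeff q → p ≋[ n ] q
  ≗⇒≋ {p} {q} p≗q = mk≋ λ i →
    subst (+ n ∣_) (sym (trans (cong (_- coeff q i) (p≗q i)) (ℤ.+-inverseʳ (coeff q i))))
      (divides (+ 0) refl)

  ≋-refl : ∀ {p} → p ≋[ n ] p
  ≋-refl = ≗⇒≋ λ _ → refl

  ≋-sym : ∀ {p q} → p ≋[ n ] q → q ≋[ n ] p
  ≋-sym {p} {q} p≋q = mk≋ λ i →
    subst (+ n ∣_) (-[a-b]≡b-a (coeff p i) (coeff q i)) (∣m⇒∣-m (∣coeff-diff p≋q i))

  ≋-trans : ∀ {p q r} → p ≋[ n ] q → q ≋[ n ] r → p ≋[ n ] r
  ≋-trans {p} {q} {r} p≋q q≋r = mk≋ λ i →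
    subst (+ n ∣_) ([a-b]+[b-c]≡a-c (coeff p i) (coeff q i) (coeff r i))
      (∣m∣n⇒∣m+n (∣coeff-diff p≋q i) (∣coeff-diff q≋r i))

  +ₚ-cong : ∀ {p p′ q q′} → p ≋[ n ] p′ → q ≋[ n ] q′ → p +ₚ q ≋[ n ] p′ +ₚ q′
  +ₚ-cong {p} {p′} {q} {q′} p≋p′ q≋q′ = mk≋ λ i →
    subst (+ n ∣_)
      (trans ([a-c]+[b-d]≡[a+b]-[c+d] (coeff p i) (coeff q i) (coeff p′ i) (coeff q′ i))
             (sym (cong₂ _-_ (coeff-+ p q i) (coeff-+ p′ q′ i))))
      (∣m∣n⇒∣m+n (∣coeff-diff p≋p′ i) (∣coeff-diff q≋q′ i))

  negₚ-cong : ∀ {p p′} → p ≋[ n ] p′ → negₚ p ≋[ n ] negₚ p′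
  negₚ-cong {p} {p′} p≋p′ = mk≋ λ i →
    subst (+ n ∣_)
      (trans (-[a-b]≡-a--b (coeff p i) (coeff p′ i)) (sym (cong₂ _-_ (coeff-neg p i) (coeff-neg p′ i))))
      (∣m⇒∣-m (∣coeff-diff p≋p′ i))

  *ₚ-congʳ : ∀ {p p′} q → p ≋[ n ] p′ → p *ₚ q ≋[ n ] p′ *ₚ q
  *ₚ-congʳ {p} {p′} q p≋p′ = mk≋ λ i → subst (+ n ∣_) (coeff-[p-p′]*q i) (∣coeff-* (p -ₚ p′) q n∣p-p′ i)
    where
    n∣p-p′ : ∀ j → + n ∣ coeff (p -ₚ p′) j
    n∣p-p′ j = subst (+ n ∣_) (sym (coeff-- p p′ j)) (∣coeff-diff p≋p′ j)
    coeff-[p-p′]*q : ∀ i → coeff ((p -ₚ p′) *ₚ q) i ≡ coeff (p *ₚ q) i - coeff (p′ *ₚ q) i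
    coeff-[p-p′]*q i =
      trans (coeff-*-distribʳ q p (negₚ p′) i) (cong (_+_ (coeff (p *ₚ q) i)) (coeff-neg-* p′ q i))

  *ₚ-cong : ∀ {p p′ q q′} → p ≋[ n ] p′ → q ≋[ n ] q′ → p *ₚ q ≋[ n ] p′ *ₚ q′
  *ₚ-cong {p} {p′} {q} {q′} p≋p′ q≋q′ =
    ≋-trans (*ₚ-congʳ q p≋p′)
      (≋-trans (≗⇒≋ (coeff-*-comm p′ q)) (≋-trans (*ₚ-congʳ p′ q≋q′) (≗⇒≋ (coeff-*-comm q′ p′))))

ℤ[x]/_ : ℕ → CommutativeRing 0ℓ 0ℓ
ℤ[x]/ n = record
  { Carrier = Poly
  ; _≈_ = CoeffCongruent n
  ; _+_ = _+ₚ_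
  ; _*_ = _*ₚ_
  ; -_ = negₚ
  ; 0# = []
  ; 1# = oneₚ
  ; isCommutativeRing = record
    { isRing = record
      { +-isAbelianGroup = record
        { isGroup = record
          { isMonoid = record
            { isSemigroup = record
              { isMagma = record
                { isEquivalence = record { refl = ≋-refl ; sym = ≋-sym ; trans = ≋-trans }
                ; ∙-cong = +ₚ-cong }
              ; assoc = λ p q r → ≡⇒≋ (+ₚ-assoc p q r) }
            ; identity = (λ p → ≋-refl) , (λ p → ≡⇒≋ (+ₚ-identityʳ p)) }
          ; inverse = (λ p → ≗⇒≋ (coeff-+ₚ-inverseˡ p))
                    , (λ p → ≗⇒≋ (coeff-+ₚ-inverseʳ p))
          ; ⁻¹-cong = negₚ-cong }
        ; comm = λ p q → ≡⇒≋ (+ₚ-comm p q) }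
      ; *-cong = *ₚ-cong
      ; *-assoc = λ p q r → ≗⇒≋ (coeff-*-assoc p q r)
      ; *-identity = (λ p → ≗⇒≋ (coeff-*-identityˡ p))
                   , (λ p → ≗⇒≋ λ i → trans (coeff-*-comm p oneₚ i) (coeff-*-identityˡ p i))
      ; distrib = (λ p q r → ≗⇒≋ (coeff-*-distribˡ p q r))
                , (λ p q r → ≗⇒≋ λ i → trans (coeff-*-distribʳ p q r i) (sym (coeff-+ (q *ₚ p) (r *ₚ p) i)))
      }
    ; *-comm = λ p q → ≗⇒≋ (coeff-*-comm p q)
    }
  }
  where
  ≡⇒≋ : ∀ {p q} → p ≡ q → p ≋[ n ] q
  ≡⇒≋ refl = ≋-refl
  coeff-+ₚ-inverseʳ : ∀ p → coeff (p +ₚ negₚ p) ≗ coeff []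
  coeff-+ₚ-inverseʳ p i = trans (cong (λ r → coeff r i) (+ₚ-comm p (negₚ p))) (coeff-+ₚ-inverseˡ p i)
  coeff-*-distribˡ : ∀ p q r → coeff (p *ₚ (q +ₚ r)) ≗ coeff ((p *ₚ q) +ₚ (p *ₚ r))
  coeff-*-distribˡ p q r i =
    trans (coeff-*-comm p (q +ₚ r) i)
      (trans (coeff-*-distribʳ p q r i)
        (trans (cong₂ _+_ (coeff-*-comm q p i) (coeff-*-comm r p i)) (sym (coeff-+ (p *ₚ q) (p *ₚ r) i))))

≋-zero? : ∀ p → Maybe ([] ≋[ 0 ] p)
≋-zero? []      = just ≋-refl
≋-zero? (a ∷ p) with a ℤ.≟ + 0 | ≋-zero? p
... | yes refl | just (mk≋ []≋p) = just (mk≋ λ { zero → divides (+ 0) refl ; (suc i) → []≋p i })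
... | _        | _               = nothing

-- Congruence modulo 0 is coefficientwise equality: identities proved by the solver in this
-- closed ring transfer to every modulus through ≋₀⇒≋.
ℤ[x] : AlmostCommutativeRing 0ℓ 0ℓ
ℤ[x] = fromCommutativeRing (ℤ[x]/ 0) ≋-zero?

≋₀⇒≋ : ∀ {n p q} → p ≋[ 0 ] q → p ≋[ n ] q
≋₀⇒≋ {n} p≋₀q = mk≋ λ i → subst (+ n ∣_) (sym (0∣⇒≡0 (∣coeff-diff p≋₀q i))) (divides (+ 0) refl)

private
  [a+b]+s[p+q]≈[a+sp]+[b+sq] : ∀ a b s p q →
    (a +ₚ b) +ₚ s *ₚ (p +ₚ q) ≋[ 0 ] (a +ₚ s *ₚ p) +ₚ (b +ₚ s *ₚ q)
  [a+b]+s[p+q]≈[a+sp]+[b+sq] = Poly-solver.solve-∀ ℤ[x]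
  -a+s[-p]≈-[a+sp] : ∀ a s p → negₚ a +ₚ s *ₚ negₚ p ≋[ 0 ] negₚ (a +ₚ s *ₚ p)
  -a+s[-p]≈-[a+sp] = Poly-solver.solve-∀ ℤ[x]
  ab+s[aq]≈a[b+sq] : ∀ a b s q → a *ₚ b +ₚ s *ₚ (a *ₚ q) ≋[ 0 ] a *ₚ (b +ₚ s *ₚ q)
  ab+s[aq]≈a[b+sq] = Poly-solver.solve-∀ ℤ[x]
  aq+s[pq]≈[a+sp]q : ∀ a s p q → a *ₚ q +ₚ s *ₚ (p *ₚ q) ≋[ 0 ] (a +ₚ s *ₚ p) *ₚ q
  aq+s[pq]≈[a+sp]q = Poly-solver.solve-∀ ℤ[x]
  0+s[1+s0]≈s : ∀ s → [] +ₚ s *ₚ (oneₚ +ₚ s *ₚ []) ≋[ 0 ] s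
  0+s[1+s0]≈s = Poly-solver.solve-∀ ℤ[x]

constₚ-* : ∀ {n} a b → constₚ (a * b) ≋[ n ] constₚ a *ₚ constₚ b
constₚ-* a b = ≗⇒≋ λ { zero → sym (ℤ.+-identityʳ (a * b)) ; (suc i) → refl }

constₚ-0 : ∀ {n} → constₚ (+ 0) ≋[ n ] []
constₚ-0 = ≗⇒≋ λ { zero → refl ; (suc i) → refl }

X*ₚ : ∀ {n} p → X *ₚ p ≋[ n ] + 0 ∷ p
X*ₚ p = ≗⇒≋ λ
  { zero    → trans (coeff-∷-*-zero (+ 0) (+ 1 ∷ []) p) (ℤ.*-zeroˡ (coeff p 0))
  ; (suc i) → trans (coeff-∷-*-suc (+ 0) (+ 1 ∷ []) p i)
                (trans (ℤ.+-identityˡ _) (coeff-*-identityˡ p i))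
  }

module _ {n : ℕ} where

  open CommutativeRing (ℤ[x]/ n)
    using (setoid; semiring; +-group; +-cong; +-congˡ; +-congʳ; *-congˡ; +-identityʳ; zeroʳ)
  open import Algebra.Properties.Semiring.Exp semiring using (_^_; ^-assocʳ)
  open import Algebra.Properties.Group +-group using (x∙y⁻¹≈ε⇒x≈y; x≈y⇒x∙y⁻¹≈ε)
  open import Relation.Binary.Reasoning.Setoid setoid

  ^ₚ≡^ : ∀ p k → p ^ₚ k ≡ p ^ k
  ^ₚ≡^ p zero    = refl
  ^ₚ≡^ p (suc k) = cong (p *ₚ_) (^ₚ≡^ p k)

  ^ₚ-assocʳ : ∀ p i j → (p ^ₚ i) ^ₚ j ≋[ n ] p ^ₚ (i ℕ.* j)
  ^ₚ-assocʳ p i j rewrite ^ₚ≡^ (p ^ₚ i) j | ^ₚ≡^ p i | ^ₚ≡^ p (i ℕ.* j) = ^-assocʳ p i j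

  compose-+ : ∀ p q s → compose (p +ₚ q) s ≋[ n ] compose p s +ₚ compose q s
  compose-+ []      q       s = ≋-refl
  compose-+ (a ∷ p) []      s = ≋-sym (+-identityʳ (compose (a ∷ p) s))
  compose-+ (a ∷ p) (b ∷ q) s = begin
    constₚ (a + b) +ₚ s *ₚ compose (p +ₚ q) s
      ≈⟨ +-congˡ {constₚ (a + b)} (*-congˡ {s} (compose-+ p q s)) ⟩
    (constₚ a +ₚ constₚ b) +ₚ s *ₚ (compose p s +ₚ compose q s)
      ≈⟨ ≋₀⇒≋ ([a+b]+s[p+q]≈[a+sp]+[b+sq] (constₚ a) (constₚ b) s (compose p s) (compose q s)) ⟩
    compose (a ∷ p) s +ₚ compose (b ∷ q) s  ∎

  compose-neg : ∀ p s → compose (negₚ p) s ≋[ n ] negₚ (compose p s)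
  compose-neg []      s = ≋-refl
  compose-neg (a ∷ p) s = begin
    negₚ (constₚ a) +ₚ s *ₚ compose (negₚ p) s  ≈⟨ +-congˡ {negₚ (constₚ a)} (*-congˡ {s} (compose-neg p s)) ⟩
    negₚ (constₚ a) +ₚ s *ₚ negₚ (compose p s)  ≈⟨ ≋₀⇒≋ (-a+s[-p]≈-[a+sp] (constₚ a) s (compose p s)) ⟩
    negₚ (compose (a ∷ p) s)                    ∎

  compose-- : ∀ p q s → compose (p -ₚ q) s ≋[ n ] compose p s -ₚ compose q s
  compose-- p q s = ≋-trans (compose-+ p (negₚ q) s) (+-congˡ {compose p s} (compose-neg q s))

  compose-map-* : ∀ a q s → compose (map (a *_) q) s ≋[ n ] constₚ a *ₚ compose q s
  compose-map-* a []      s = ≋-sym (zeroʳ (constₚ a))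
  compose-map-* a (b ∷ q) s = begin
    constₚ (a * b) +ₚ s *ₚ compose (map (a *_) q) s
      ≈⟨ +-cong (constₚ-* a b) (*-congˡ {s} (compose-map-* a q s)) ⟩
    constₚ a *ₚ constₚ b +ₚ s *ₚ (constₚ a *ₚ compose q s)
      ≈⟨ ≋₀⇒≋ (ab+s[aq]≈a[b+sq] (constₚ a) (constₚ b) s (compose q s)) ⟩
    constₚ a *ₚ compose (b ∷ q) s  ∎

  compose-* : ∀ p q s → compose (p *ₚ q) s ≋[ n ] compose p s *ₚ compose q s
  compose-* []      q s = ≋-refl
  compose-* (a ∷ p) q s = begin
    compose (map (a *_) q +ₚ (+ 0 ∷ p *ₚ q)) s
      ≈⟨ compose-+ (map (a *_) q) (+ 0 ∷ p *ₚ q) s ⟩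
    compose (map (a *_) q) s +ₚ (constₚ (+ 0) +ₚ s *ₚ compose (p *ₚ q) s)
      ≈⟨ +-cong (compose-map-* a q s) (+-cong constₚ-0 (*-congˡ {s} (compose-* p q s))) ⟩
    constₚ a *ₚ compose q s +ₚ s *ₚ (compose p s *ₚ compose q s)
      ≈⟨ ≋₀⇒≋ (aq+s[pq]≈[a+sp]q (constₚ a) s (compose p s) (compose q s)) ⟩
    compose (a ∷ p) s *ₚ compose q s  ∎

  compose-const : ∀ a s → compose (constₚ a) s ≋[ n ] constₚ a
  compose-const a s = ≋-trans (+-congˡ {constₚ a} (zeroʳ s)) (+-identityʳ (constₚ a))

  compose-X : ∀ s → compose X s ≋[ n ] s
  compose-X s = ≋-trans (+-congʳ {s *ₚ (oneₚ +ₚ s *ₚ [])} constₚ-0) (≋₀⇒≋ (0+s[1+s0]≈s s))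

  compose-^ : ∀ p k s → compose (p ^ₚ k) s ≋[ n ] compose p s ^ₚ k
  compose-^ p zero    s = compose-const (+ 1) s
  compose-^ p (suc k) s = ≋-trans (compose-* p (p ^ₚ k) s) (*-congˡ {compose p s} (compose-^ p k s))

  compose-X-right : ∀ p → compose p X ≋[ n ] p
  compose-X-right []      = ≋-refl
  compose-X-right (a ∷ p) = begin
    constₚ a +ₚ X *ₚ compose p X  ≈⟨ +-congˡ {constₚ a} (≋-trans (*-congˡ {X} (compose-X-right p)) (X*ₚ p)) ⟩
    constₚ a +ₚ (+ 0 ∷ p)         ≈⟨ ≗⇒≋ (λ { zero → ℤ.+-identityʳ a ; (suc i) → refl }) ⟩
    a ∷ p                         ∎

  compose-≋0 : ∀ p s → p ≋[ n ] [] → compose p s ≋[ n ] []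
  compose-≋0 []      s p≋0 = ≋-refl
  compose-≋0 (a ∷ p) s p≋0 = begin
    constₚ a +ₚ s *ₚ compose p s  ≈⟨ +-cong a≋0 (*-congˡ {s} (compose-≋0 p s p≋0′)) ⟩
    [] +ₚ s *ₚ []                 ≈⟨ zeroʳ s ⟩
    []                            ∎
    where
    a≋0 : constₚ a ≋[ n ] []
    a≋0 = mk≋ λ { zero → ∣coeff-diff p≋0 0 ; (suc i) → divides (+ 0) refl }
    p≋0′ : p ≋[ n ] []
    p≋0′ = mk≋ λ i → ∣coeff-diff p≋0 (suc i)

  compose-congˡ : ∀ {p q} s → p ≋[ n ] q → compose p s ≋[ n ] compose q s
  compose-congˡ {p} {q} s p≋q = x∙y⁻¹≈ε⇒x≈y (compose p s) (compose q s) (begin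
    compose p s -ₚ compose q s  ≈⟨ compose-- p q s ⟨
    compose (p -ₚ q) s          ≈⟨ compose-≋0 (p -ₚ q) s (x≈y⇒x∙y⁻¹≈ε p≋q) ⟩
    []                          ∎)

-- Congruence modulo the ideal (n, f)

private
  x-z≈[x-y]+[y-z] : ∀ x y z → x -ₚ z ≋[ 0 ] (x -ₚ y) +ₚ (y -ₚ z)
  x-z≈[x-y]+[y-z] = Poly-solver.solve-∀ ℤ[x]
  y-x≈-[x-y] : ∀ x y → y -ₚ x ≋[ 0 ] negₚ (x -ₚ y)
  y-x≈-[x-y] = Poly-solver.solve-∀ ℤ[x]
  [x+u]-[y+v]≈[x-y]+[u-v] : ∀ x y u v → (x +ₚ u) -ₚ (y +ₚ v) ≋[ 0 ] (x -ₚ y) +ₚ (u -ₚ v)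
  [x+u]-[y+v]≈[x-y]+[u-v] = Poly-solver.solve-∀ ℤ[x]
  xu-yv≈[x-y]u+y[u-v] : ∀ x y u v → x *ₚ u -ₚ y *ₚ v ≋[ 0 ] (x -ₚ y) *ₚ u +ₚ y *ₚ (u -ₚ v)
  xu-yv≈[x-y]u+y[u-v] = Poly-solver.solve-∀ ℤ[x]
  [rg]u+y[sg]≈[ru+ys]g : ∀ r g u y s → (r *ₚ g) *ₚ u +ₚ y *ₚ (s *ₚ g) ≋[ 0 ] (r *ₚ u +ₚ y *ₚ s) *ₚ g
  [rg]u+y[sg]≈[ru+ys]g = Poly-solver.solve-∀ ℤ[x]
  -[rg]≈[-r]g : ∀ r g → negₚ (r *ₚ g) ≋[ 0 ] negₚ r *ₚ g
  -[rg]≈[-r]g = Poly-solver.solve-∀ ℤ[x]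
  rg+sg≈[r+s]g : ∀ r s g → r *ₚ g +ₚ s *ₚ g ≋[ 0 ] (r +ₚ s) *ₚ g
  rg+sg≈[r+s]g = Poly-solver.solve-∀ ℤ[x]
  x-x≈0 : ∀ x → x -ₚ x ≋[ 0 ] []
  x-x≈0 = Poly-solver.solve-∀ ℤ[x]
  g-0≈1g : ∀ g → g -ₚ [] ≋[ 0 ] oneₚ *ₚ g
  g-0≈1g = Poly-solver.solve-∀ ℤ[x]

module Modulo (n : ℕ) (f : Poly) where

  open CommutativeRing (ℤ[x]/ n) using (setoid; +-cong; -‿cong; *-congʳ; *-congˡ)
  open import Relation.Binary.Reasoning.Setoid setoid

  -- CongMod p q n f, as a record for the same reason as CoeffCongruent.
  infix 4 _∼_
  record _∼_ (p q : Poly) : Set where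
    constructor mk∼
    field
      multiplier : Poly
      p-q≋multiplier*f : p -ₚ q ≋[ n ] multiplier *ₚ f

  CongMod⇒∼ : ∀ {p q} → CongMod p q n f → p ∼ q
  CongMod⇒∼ (r , p-q≈rf) = mk∼ r (≈⇒≋ p-q≈rf)

  ∼⇒CongMod : ∀ {p q} → p ∼ q → CongMod p q n f
  ∼⇒CongMod (mk∼ r p-q≋rf) = r , ≋⇒≈ p-q≋rf

  ≋⇒∼ : ∀ {p q} → p ≋[ n ] q → p ∼ q
  ≋⇒∼ {p} {q} p≋q = mk∼ [] (begin
    p -ₚ q  ≈⟨ +-cong p≋q ≋-refl ⟩
    q -ₚ q  ≈⟨ ≋₀⇒≋ (x-x≈0 q) ⟩
    []      ∎)

  ∼-refl : ∀ {p} → p ∼ p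
  ∼-refl = ≋⇒∼ ≋-refl

  ∼-sym : ∀ {p q} → p ∼ q → q ∼ p
  ∼-sym {p} {q} (mk∼ r p-q≋rf) = mk∼ (negₚ r) (begin
    q -ₚ p           ≈⟨ ≋₀⇒≋ (y-x≈-[x-y] p q) ⟩
    negₚ (p -ₚ q)    ≈⟨ -‿cong p-q≋rf ⟩
    negₚ (r *ₚ f)    ≈⟨ ≋₀⇒≋ (-[rg]≈[-r]g r f) ⟩
    negₚ r *ₚ f      ∎)

  ∼-trans : ∀ {p q s} → p ∼ q → q ∼ s → p ∼ s
  ∼-trans {p} {q} {s} (mk∼ r p-q≋rf) (mk∼ t q-s≋tf) = mk∼ (r +ₚ t) (begin
    p -ₚ s                 ≈⟨ ≋₀⇒≋ (x-z≈[x-y]+[y-z] p q s) ⟩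
    (p -ₚ q) +ₚ (q -ₚ s)   ≈⟨ +-cong p-q≋rf q-s≋tf ⟩
    r *ₚ f +ₚ t *ₚ f       ≈⟨ ≋₀⇒≋ (rg+sg≈[r+s]g r t f) ⟩
    (r +ₚ t) *ₚ f          ∎)

  ∼-setoid : Setoid _ _
  ∼-setoid = record
    { Carrier = Poly
    ; _≈_ = _∼_
    ; isEquivalence = record { refl = ∼-refl ; sym = ∼-sym ; trans = ∼-trans }
    }

  +ₚ-cong-∼ : ∀ {p p′ q q′} → p ∼ p′ → q ∼ q′ → p +ₚ q ∼ p′ +ₚ q′
  +ₚ-cong-∼ {p} {p′} {q} {q′} (mk∼ r p-p′≋rf) (mk∼ t q-q′≋tf) = mk∼ (r +ₚ t) (begin
    (p +ₚ q) -ₚ (p′ +ₚ q′)   ≈⟨ ≋₀⇒≋ ([x+u]-[y+v]≈[x-y]+[u-v] p p′ q q′) ⟩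
    (p -ₚ p′) +ₚ (q -ₚ q′)   ≈⟨ +-cong p-p′≋rf q-q′≋tf ⟩
    r *ₚ f +ₚ t *ₚ f         ≈⟨ ≋₀⇒≋ (rg+sg≈[r+s]g r t f) ⟩
    (r +ₚ t) *ₚ f            ∎)

  *ₚ-cong-∼ : ∀ {p p′ q q′} → p ∼ p′ → q ∼ q′ → p *ₚ q ∼ p′ *ₚ q′
  *ₚ-cong-∼ {p} {p′} {q} {q′} (mk∼ r p-p′≋rf) (mk∼ t q-q′≋tf) = mk∼ (r *ₚ q +ₚ p′ *ₚ t) (begin
    p *ₚ q -ₚ p′ *ₚ q′                     ≈⟨ ≋₀⇒≋ (xu-yv≈[x-y]u+y[u-v] p p′ q q′) ⟩
    (p -ₚ p′) *ₚ q +ₚ p′ *ₚ (q -ₚ q′)      ≈⟨ +-cong (*-congʳ p-p′≋rf) (*-congˡ {p′} q-q′≋tf) ⟩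
    (r *ₚ f) *ₚ q +ₚ p′ *ₚ (t *ₚ f)        ≈⟨ ≋₀⇒≋ ([rg]u+y[sg]≈[ru+ys]g r f q p′ t) ⟩
    (r *ₚ q +ₚ p′ *ₚ t) *ₚ f               ∎)

  f∼0 : f ∼ []
  f∼0 = mk∼ oneₚ (≋₀⇒≋ (g-0≈1g f))

private
  x≈y+[x-y] : ∀ x y → x ≋[ 0 ] y +ₚ (x -ₚ y)
  x≈y+[x-y] = Poly-solver.solve-∀ ℤ[x]
  x+y0≈x : ∀ x y → x +ₚ y *ₚ [] ≋[ 0 ] x
  x+y0≈x = Poly-solver.solve-∀ ℤ[x]

module _ {n : ℕ} {f : Poly} where

  open Modulo n f
  open CommutativeRing (ℤ[x]/ n) using (+-cong; +-congˡ)
  open import Relation.Binary.Reasoning.Setoid ∼-setoid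

  ∼⇒≈+*f : ∀ {p q} → p ∼ q → ∃[ r ] (p ≈[ n ] (q +ₚ r *ₚ f))
  ∼⇒≈+*f {p} {q} (mk∼ r p-q≋rf) =
    r , ≋⇒≈ (≋-trans (≋₀⇒≋ (x≈y+[x-y] p q)) (+-congˡ {q} p-q≋rf))

  ^ₚ-cong-∼ : ∀ {p q} k → p ∼ q → p ^ₚ k ∼ q ^ₚ k
  ^ₚ-cong-∼ zero    p∼q = ∼-refl
  ^ₚ-cong-∼ (suc k) p∼q = *ₚ-cong-∼ p∼q (^ₚ-cong-∼ k p∼q)

  compose-congʳ-∼ : ∀ p {s t} → s ∼ t → compose p s ∼ compose p t
  compose-congʳ-∼ []      s∼t = ∼-refl
  compose-congʳ-∼ (a ∷ p) s∼t = +ₚ-cong-∼ ∼-refl (*ₚ-cong-∼ s∼t (compose-congʳ-∼ p s∼t))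

  compose-congˡ-∼ : ∀ s → compose f s ∼ [] → ∀ {p q} → p ∼ q → compose p s ∼ compose q s
  compose-congˡ-∼ s f[s]∼0 {p} {q} (mk∼ r p-q≋rf) = begin
    compose p s                                 ≈⟨ ≋⇒∼ (compose-congˡ s (≋₀⇒≋ (x≈y+[x-y] p q))) ⟩
    compose (q +ₚ (p -ₚ q)) s                   ≈⟨ ≋⇒∼ (compose-+ q (p -ₚ q) s) ⟩
    compose q s +ₚ compose (p -ₚ q) s           ≈⟨ ≋⇒∼ (+-congˡ {compose q s} compose[p-q]≋) ⟩
    compose q s +ₚ compose r s *ₚ compose f s
      ≈⟨ +ₚ-cong-∼ (∼-refl {compose q s}) (*ₚ-cong-∼ (∼-refl {compose r s}) f[s]∼0) ⟩
    compose q s +ₚ compose r s *ₚ []            ≈⟨ ≋⇒∼ (≋₀⇒≋ (x+y0≈x (compose q s) (compose r s))) ⟩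
    compose q s                                 ∎
    where
    compose[p-q]≋ : compose (p -ₚ q) s ≋[ n ] compose r s *ₚ compose f s
    compose[p-q]≋ = ≋-trans (compose-congˡ s p-q≋rf) (compose-* r f s)

gcd≡1⇒∣k∣≡1 : ∀ {i j k} → gcd i j ≡ + 1 → k Unsigned.∣ i → k Unsigned.∣ j → ℤ.∣ k ∣ ≡ 1
gcd≡1⇒∣k∣≡1 {i} {j} {k} gcd≡1 k∣i k∣j =
  ℕ.∣1⇒≡1 (subst (Unsigned._∣_ k) gcd≡1 (gcd-greatest {i} {j} {k} k∣i k∣j))

gcd≡1-∣ʳ : ∀ {i j k} → gcd i j ≡ + 1 → k Unsigned.∣ j → gcd i k ≡ + 1
gcd≡1-∣ʳ {i} {j} {k} gcd≡1 k∣j =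
  cong +_ (gcd≡1⇒∣k∣≡1 {i} {j} {gcd i k} gcd≡1
            (gcd[i,j]∣i i k) (ℕ.∣-trans {ℤ.∣ gcd i k ∣} (gcd[i,j]∣j i k) k∣j))

private
  -ym-1≡-[1+ym] : ∀ y m → - y * m - + 1 ≡ - (+ 1 + y * m)
  -ym-1≡-[1+ym] = solve-∀
  [1+xn]-1≡xn : ∀ x n → (+ 1 + x * n) - + 1 ≡ x * n
  [1+xn]-1≡xn = solve-∀

  pos-1+* : ∀ a b → + (1 ℕ.+ a ℕ.* b) ≡ + 1 + + a * + b
  pos-1+* a b = trans (ℤ.pos-+ 1 (a ℕ.* b)) (cong (_+_ (+ 1)) (ℤ.pos-* a b))

inverse-mod-ℕ : ∀ {n m} → Coprime n m → ∃[ t ] (+ n ∣ t * + m - + 1)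
inverse-mod-ℕ {n} {m} n⊥m with coprime-Bézout n⊥m
... | Bézout.+- x y 1+ym≡xn = - + y , divides (- + x) (begin
  - + y * + m - + 1    ≡⟨ -ym-1≡-[1+ym] (+ y) (+ m) ⟩
  - (+ 1 + + y * + m)  ≡⟨ cong -_ (trans (sym (pos-1+* y m)) (trans (cong +_ 1+ym≡xn) (ℤ.pos-* x n))) ⟩
  - (+ x * + n)        ≡⟨ ℤ.neg-distribˡ-* (+ x) (+ n) ⟩
  - + x * + n          ∎)
  where open ≡-Reasoning
... | Bézout.-+ x y 1+xn≡ym = + y , divides (+ x) (begin
  + y * + m - + 1
    ≡⟨ cong (_- + 1) (trans (sym (ℤ.pos-* y m)) (trans (cong +_ (sym 1+xn≡ym)) (pos-1+* x n))) ⟩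
  (+ 1 + + x * + n) - + 1    ≡⟨ [1+xn]-1≡xn (+ x) (+ n) ⟩
  + x * + n                  ∎)
  where open ≡-Reasoning

inverse-mod : ∀ n a → gcd (+ n) a ≡ + 1 → ∃[ s ] (+ n ∣ s * a - + 1)
inverse-mod n a gcd≡1 with inverse-mod-ℕ (gcd≡1⇒coprime (cong ℤ.∣_∣ gcd≡1)) | ℤ.+∣i∣≡i⊎+∣i∣≡-i a
... | t , n∣t∣a∣-1 | inj₁ ∣a∣≡a  = t , subst (λ z → + n ∣ t * z - + 1) ∣a∣≡a n∣t∣a∣-1
... | t , n∣t∣a∣-1 | inj₂ ∣a∣≡-a = - t , subst (λ z → + n ∣ z - + 1) t∣a∣≡-ta n∣t∣a∣-1
  where
  t∣a∣≡-ta : t * + ℤ.∣ a ∣ ≡ - t * a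
  t∣a∣≡-ta = trans (cong (t *_) ∣a∣≡-a) (trans (sym (ℤ.neg-distribʳ-* t a)) (ℤ.neg-distribˡ-* t a))

-- The quadratic x² − bx − c

disc-quadratic : ∀ a₀ a₁ → disc (a₀ ∷ a₁ ∷ []) ≡ a₁ * a₁ - + 4 * a₀
disc-quadratic a₀ a₁ = begin
  disc (a₀ ∷ a₁ ∷ [])  ≡⟨⟩
  -- the cofactor expansion of the Sylvester determinant along its first row (1, a₁, a₀)
  - + 1 * (  + 1 * (+ 1 * (+ 1 * a₁) * (+ 1 * (+ 1 * a₁) * + 1 + + 0) + + 0)
           + (- + 1 * a₁ * (+ 2 * (+ 1 * (+ 1 * a₁) * + 1 + + 0) + + 0)
           + (+ 1 * a₀ * (+ 4 + (- + 1 * (+ 1 * a₁) * + 0 + + 0)) + + 0)))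
    ≡⟨ solve (a₀ ∷ a₁ ∷ []) ⟩
  a₁ * a₁ - + 4 * a₀  ∎
  where open ≡-Reasoning

private
  f[B-Y]≈f[Y] : ∀ B C Y →
    negₚ C +ₚ (B -ₚ Y) *ₚ (negₚ B +ₚ (B -ₚ Y) *ₚ (oneₚ +ₚ (B -ₚ Y) *ₚ []))
      ≋[ 0 ] negₚ C +ₚ Y *ₚ (negₚ B +ₚ Y *ₚ (oneₚ +ₚ Y *ₚ []))
  f[B-Y]≈f[Y] = Poly-solver.solve-∀ ℤ[x]
  B-[B-Y]≈Y : ∀ B Y → B -ₚ (B -ₚ Y) ≋[ 0 ] Y
  B-[B-Y]≈Y = Poly-solver.solve-∀ ℤ[x]
  [B-2Y]²≈B²+4C+4f[Y] : ∀ B C Y →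
    ((B -ₚ Y) -ₚ Y) *ₚ ((B -ₚ Y) -ₚ Y)
      ≋[ 0 ] (B *ₚ B +ₚ (oneₚ +ₚ oneₚ +ₚ oneₚ +ₚ oneₚ) *ₚ C)
             +ₚ (oneₚ +ₚ oneₚ +ₚ oneₚ +ₚ oneₚ) *ₚ (negₚ C +ₚ Y *ₚ (negₚ B +ₚ Y *ₚ (oneₚ +ₚ Y *ₚ [])))
  [B-2Y]²≈B²+4C+4f[Y] = Poly-solver.solve-∀ ℤ[x]
  [-b][-b]-4[-c]≡bb+4c : ∀ b c → - b * - b - + 4 * - c ≡ b * b + + 4 * c
  [-b][-b]-4[-c]≡bb+4c = solve-∀

module Quadratic (b c : ℤ) where

  f : Poly
  f = monic (- c ∷ - b ∷ [])

  σ : Poly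
  σ = constₚ b -ₚ X

  Δ : ℤ
  Δ = b * b + + 4 * c

  disc-f≡Δ : disc (- c ∷ - b ∷ []) ≡ Δ
  disc-f≡Δ = trans (disc-quadratic (- c) (- b)) ([-b][-b]-4[-c]≡bb+4c b c)

  module _ {n : ℕ} (coprime : gcd (+ n) (+ 2 * - c * Δ) ≡ + 1) where

    n-odd : ¬ (2 ℕ.∣ n)
    n-odd 2∣n
      with gcd≡1⇒∣k∣≡1 {+ n} {+ 2 * - c * Δ} {+ 2} coprime 2∣n
             (∣⇒∣ᵤ (∣m⇒∣m*n Δ (∣m⇒∣m*n (- c) (∣-refl {+ 2}))))
    ... | ()

    n-coprime-f₀·disc : gcd (+ n) (- c * disc (- c ∷ - b ∷ [])) ≡ + 1
    n-coprime-f₀·disc = subst (λ d → gcd (+ n) (- c * d) ≡ + 1) (sym disc-f≡Δ)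
      (gcd≡1-∣ʳ {+ n} {+ 2 * - c * Δ} { - c * Δ} coprime (∣⇒∣ᵤ [-c]Δ∣2[-c]Δ))
      where
      [-c]Δ∣2[-c]Δ : - c * Δ ∣ + 2 * - c * Δ
      [-c]Δ∣2[-c]Δ = subst (- c * Δ ∣_) (sym (ℤ.*-assoc (+ 2) (- c) Δ)) (∣n⇒∣m*n (+ 2) (∣-refl { - c * Δ}))

    Δ-invertible : ∃[ s ] (+ n ∣ s * Δ - + 1)
    Δ-invertible = inverse-mod n Δ
      (gcd≡1-∣ʳ {+ n} {+ 2 * - c * Δ} {Δ} coprime (∣⇒∣ᵤ (∣n⇒∣m*n (+ 2 * - c) (∣-refl {Δ}))))

  module _ {n : ℕ} where

    open CommutativeRing (ℤ[x]/ n) using (setoid; +-cong; -‿cong; *-congˡ; *-assoc)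
    open import Relation.Binary.Reasoning.Setoid setoid

    f∘σ≋f : compose f σ ≋[ n ] f
    f∘σ≋f = ≋-trans (≋₀⇒≋ (f[B-Y]≈f[Y] (constₚ b) (constₚ c) X)) (compose-X-right f)

    σ∘σ≋X : compose σ σ ≋[ n ] X
    σ∘σ≋X = begin
      compose (constₚ b -ₚ X) σ          ≈⟨ compose-- (constₚ b) X σ ⟩
      compose (constₚ b) σ -ₚ compose X σ ≈⟨ +-cong (compose-const b σ) (-‿cong (compose-X σ)) ⟩
      constₚ b -ₚ σ                       ≈⟨ ≋₀⇒≋ (B-[B-Y]≈Y (constₚ b) X) ⟩
      X                                   ∎

    [σ-X]²≋Δ+4f : (σ -ₚ X) *ₚ (σ -ₚ X) ≋[ n ] constₚ Δ +ₚ constₚ (+ 4) *ₚ f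
    [σ-X]²≋Δ+4f = begin
      (σ -ₚ X) *ₚ (σ -ₚ X)
        ≈⟨ ≋₀⇒≋ ([B-2Y]²≈B²+4C+4f[Y] (constₚ b) (constₚ c) X) ⟩
      (constₚ b *ₚ constₚ b +ₚ constₚ (+ 4) *ₚ constₚ c) +ₚ constₚ (+ 4) *ₚ compose f X
        ≈⟨ +-cong (+-cong (constₚ-* b b) (constₚ-* (+ 4) c)) (*-congˡ {constₚ (+ 4)} (≋-sym (compose-X-right f))) ⟨
      constₚ Δ +ₚ constₚ (+ 4) *ₚ f
        ∎

    constₚ-inverse : ∀ s → + n ∣ s * Δ - + 1 → constₚ s *ₚ constₚ Δ ≋[ n ] oneₚ
    constₚ-inverse s n∣sΔ-1 =
      ≋-trans (≋-sym (constₚ-* s Δ)) (mk≋ λ { zero → n∣sΔ-1 ; (suc i) → divides (+ 0) refl })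

  module _ {n : ℕ} (Xⁿ≡σ : CongMod (X ^ₚ n) σ n f) where

    open Modulo n f
    open CommutativeRing (ℤ[x]/ n) using (*-congˡ; *-assoc)
    open import Relation.Binary.Reasoning.Setoid ∼-setoid

    private
      Xⁿ∼σ : X ^ₚ n ∼ σ
      Xⁿ∼σ = CongMod⇒∼ Xⁿ≡σ

      [σ-X]²∼Δ : (σ -ₚ X) *ₚ (σ -ₚ X) ∼ constₚ Δ
      [σ-X]²∼Δ = begin
        (σ -ₚ X) *ₚ (σ -ₚ X)            ≈⟨ ≋⇒∼ [σ-X]²≋Δ+4f ⟩
        constₚ Δ +ₚ constₚ (+ 4) *ₚ f   ≈⟨ +ₚ-cong-∼ (∼-refl {constₚ Δ}) (*ₚ-cong-∼ (∼-refl {constₚ (+ 4)}) f∼0) ⟩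
        constₚ Δ +ₚ constₚ (+ 4) *ₚ []  ≈⟨ ≋⇒∼ (≋₀⇒≋ (x+y0≈x (constₚ Δ) (constₚ (+ 4)))) ⟩
        constₚ Δ                        ∎

    Xⁿ²≡X : CongMod (X ^ₚ (n ℕ.^ 2)) X n f
    Xⁿ²≡X = ∼⇒CongMod (begin
      X ^ₚ (n ℕ.^ 2)       ≡⟨ cong (λ k → X ^ₚ (n ℕ.* k)) (ℕ.^-identityʳ n) ⟩
      X ^ₚ (n ℕ.* n)       ≈⟨ ≋⇒∼ (≋-sym (^ₚ-assocʳ X n n)) ⟩
      (X ^ₚ n) ^ₚ n        ≈⟨ ^ₚ-cong-∼ n Xⁿ∼σ ⟩
      σ ^ₚ n               ≈⟨ ^ₚ-cong-∼ n (≋⇒∼ (compose-X σ)) ⟨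
      compose X σ ^ₚ n     ≈⟨ ≋⇒∼ (compose-^ X n σ) ⟨
      compose (X ^ₚ n) σ   ≈⟨ compose-congˡ-∼ σ (∼-trans (≋⇒∼ f∘σ≋f) f∼0) Xⁿ∼σ ⟩
      compose σ σ          ≈⟨ ≋⇒∼ σ∘σ≋X ⟩
      X                    ∎)

    f[Xⁿ]≡0 : ∃[ q ] (compose f (X ^ₚ n) ≈[ n ] (q *ₚ f))
    f[Xⁿ]≡0 = ∼⇒≈+*f (begin
      compose f (X ^ₚ n)  ≈⟨ compose-congʳ-∼ f Xⁿ∼σ ⟩
      compose f σ         ≈⟨ ≋⇒∼ f∘σ≋f ⟩
      f                   ≈⟨ f∼0 ⟩
      []                  ∎)

    Xⁿ-X-invertible : ∃[ s ] (+ n ∣ s * Δ - + 1) →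
      ∃[ a ] ∃[ r ] (oneₚ ≈[ n ] ((a *ₚ (X ^ₚ n -ₚ X)) +ₚ (r *ₚ f)))
    Xⁿ-X-invertible (s , n∣sΔ-1) = a , ∼⇒≈+*f (∼-sym (begin
      a *ₚ (X ^ₚ n -ₚ X)                     ≈⟨ *ₚ-cong-∼ (∼-refl {a}) (+ₚ-cong-∼ Xⁿ∼σ (∼-refl {negₚ X})) ⟩
      a *ₚ (σ -ₚ X)                          ≈⟨ ≋⇒∼ (*-assoc (constₚ s) (σ -ₚ X) (σ -ₚ X)) ⟩
      constₚ s *ₚ ((σ -ₚ X) *ₚ (σ -ₚ X))     ≈⟨ *ₚ-cong-∼ (∼-refl {constₚ s}) [σ-X]²∼Δ ⟩
      constₚ s *ₚ constₚ Δ                   ≈⟨ ≋⇒∼ (constₚ-inverse s n∣sΔ-1) ⟩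
      oneₚ                                   ∎))
      where
      a : Poly
      a = constₚ s *ₚ (σ -ₚ X)

for-1-and-2 : {P : ℕ → Set} → P 1 → P 2 → ∀ i → 1 ≤ i → i ≤ 2 → P i
for-1-and-2 p₁ p₂ 1 _ _ = p₁
for-1-and-2 p₁ p₂ 2 _ _ = p₂
for-1-and-2 p₁ p₂ (suc (suc (suc _))) _ (s≤s (s≤s ()))

for-2 : {P : ℕ → Set} → P 2 → ∀ i → 2 ≤ i → i ≤ 2 → P i
for-2 {P} p₂ i 2≤i i≤2 = subst P (ℕ.≤-antisym 2≤i i≤2) p₂

module _ {n : ℕ} where

  open CommutativeRing (ℤ[x]/ n) using (*-identityˡ; *-identityʳ)

  gcmd-of-multiple : ∀ {g} hcs → ∃[ u ] (g ≈[ n ] (u *ₚ monic hcs)) → IsGcmd n g (monic hcs) hcs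
  gcmd-of-multiple hcs h∣g =
    ([] , oneₚ , ≋⇒≈ (≋-sym (*-identityˡ (monic hcs)))) , h∣g , (oneₚ , ≋⇒≈ (≋-sym (*-identityˡ (monic hcs))))

  gcmd-of-comaximal : ∀ {g₁ g₂} → ∃[ a ] ∃[ b ] (oneₚ ≈[ n ] ((a *ₚ g₁) +ₚ (b *ₚ g₂))) → IsGcmd n g₁ g₂ []
  gcmd-of-comaximal {g₁} {g₂} 1∈⟨g₁,g₂⟩ =
    1∈⟨g₁,g₂⟩ , (g₁ , ≋⇒≈ (≋-sym (*-identityʳ g₁))) , (g₂ , ≋⇒≈ (≋-sym (*-identityʳ g₂)))

  private
    X^[n^1] : ∀ {P : Poly → Set} → P (X ^ₚ n) → P (X ^ₚ (n ℕ.^ 1))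
    X^[n^1] {P} = subst (λ k → P (X ^ₚ k)) (sym (ℕ.^-identityʳ n))

  frobeniusPP-split : ∀ {a₀ a₁} → ¬ (2 ℕ.∣ n) → 1 < n → gcd (+ n) (a₀ * disc (a₀ ∷ a₁ ∷ [])) ≡ + 1
    → CongMod (X ^ₚ n) X n (monic (a₀ ∷ a₁ ∷ []))
    → Jacobi (disc (a₀ ∷ a₁ ∷ [])) n (+ 1)
    → FrobeniusPP n (a₀ ∷ a₁ ∷ [])
  frobeniusPP-split {a₀} {a₁} odd 1<n coprime Xⁿ≡X jacobi =
    odd , 1<n , coprime , F , g , refl
    , for-1-and-2 (gcmd-of-multiple cs (X^[n^1] {λ p → CongMod p X n f} Xⁿ≡X))
                  (gcmd-of-multiple [] (Xⁿ²-X , ≋⇒≈ (≋-sym (*-identityʳ Xⁿ²-X))))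
    , for-1-and-2 (≋⇒≈ (≋-sym (*-identityʳ f))) (≋⇒≈ (≋-sym (*-identityʳ oneₚ)))
    , refl
    , for-2 (compose oneₚ (X ^ₚ n) , ≋⇒≈ (≋-sym (*-identityʳ (compose oneₚ (X ^ₚ n)))))
    , jacobi
    where
    cs : List ℤ
    cs = a₀ ∷ a₁ ∷ []
    f Xⁿ²-X : Poly
    f = monic cs
    Xⁿ²-X = X ^ₚ (n ℕ.^ 2) -ₚ X
    F g : ℕ → List ℤ
    F 1 = cs
    F _ = []
    g 0 = cs
    g _ = []

  frobeniusPP-inert : ∀ {a₀ a₁} → ¬ (2 ℕ.∣ n) → 1 < n → gcd (+ n) (a₀ * disc (a₀ ∷ a₁ ∷ [])) ≡ + 1
    → ∃[ a ] ∃[ b ] (oneₚ ≈[ n ] ((a *ₚ (X ^ₚ n -ₚ X)) +ₚ (b *ₚ monic (a₀ ∷ a₁ ∷ []))))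
    → CongMod (X ^ₚ (n ℕ.^ 2)) X n (monic (a₀ ∷ a₁ ∷ []))
    → ∃[ q ] (compose (monic (a₀ ∷ a₁ ∷ [])) (X ^ₚ n) ≈[ n ] (q *ₚ monic (a₀ ∷ a₁ ∷ [])))
    → Jacobi (disc (a₀ ∷ a₁ ∷ [])) n (- + 1)
    → FrobeniusPP n (a₀ ∷ a₁ ∷ [])
  frobeniusPP-inert {a₀} {a₁} odd 1<n coprime 1∈⟨Xⁿ-X,f⟩ Xⁿ²≡X f[Xⁿ]≡0 jacobi =
    odd , 1<n , coprime , F , g , refl
    , for-1-and-2
        (gcmd-of-comaximal
          (X^[n^1] {λ p → ∃[ a ] ∃[ b ] (oneₚ ≈[ n ] ((a *ₚ (p -ₚ X)) +ₚ (b *ₚ f)))} 1∈⟨Xⁿ-X,f⟩))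
                  (gcmd-of-multiple cs Xⁿ²≡X)
    , for-1-and-2 (≋⇒≈ (≋-sym (*-identityˡ f))) (≋⇒≈ (≋-sym (*-identityʳ f)))
    , refl
    , for-2 f[Xⁿ]≡0
    , jacobi
    where
    cs : List ℤ
    cs = a₀ ∷ a₁ ∷ []
    f : Poly
    f = monic cs
    F g : ℕ → List ℤ
    F 2 = cs
    F _ = []
    g 0 = cs
    g 1 = cs
    g _ = []

theorem7p1 : (b c : ℤ) (n : ℕ) → 1 < n
    → gcd (+ n) (+ 2 * (- c) * (b * b + + 4 * c)) ≡ + 1
    → (Jacobi (b * b + + 4 * c) n (+ 1)
    → CongMod (X ^ₚ n) X n (monic (- c ∷ - b ∷ []))
    → FrobeniusPP n (- c ∷ - b ∷ []))
    × (Jacobi (b * b + + 4 * c) n (- + 1)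
    → CongMod (X ^ₚ n) (constₚ b -ₚ X) n (monic (- c ∷ - b ∷ []))
    → FrobeniusPP n (- c ∷ - b ∷ []))
theorem7p1 b c n 1<n coprime =
    (λ jacobi Xⁿ≡X →
       frobeniusPP-split (n-odd {n} coprime) 1<n (n-coprime-f₀·disc {n} coprime) Xⁿ≡X (jacobi-disc jacobi))
  , (λ jacobi Xⁿ≡σ →
       frobeniusPP-inert (n-odd {n} coprime) 1<n (n-coprime-f₀·disc {n} coprime)
         (Xⁿ-X-invertible Xⁿ≡σ (Δ-invertible {n} coprime)) (Xⁿ²≡X Xⁿ≡σ) (f[Xⁿ]≡0 Xⁿ≡σ) (jacobi-disc jacobi))
  where
  open Quadratic b c
  jacobi-disc : ∀ {j} → Jacobi Δ n j → Jacobi (disc (- c ∷ - b ∷ [])) n j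
  jacobi-disc = subst (λ d → Jacobi d n _) (sym disc-f≡Δ)
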